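{- The class of Urquhart doubly preordered sets does not have the amalgamation property.
   Context: An Urquhart doubly preordered set is a set $X$ with two preorders (reflexive transitive relations) $\leq_1,\leq_2$ satisfying condition (U): for all $x,y\in X$, if $x\leq_1 y$ and $x\leq_2 y$ then $x=y$. Embeddings are injective maps preserving and reflecting both relations. A class $\mathcal K$ has the amalgamation property if for all $\mathbf A,\mathbf B,\mathbf C\in\mathcal K$ and embeddings $\iota_1:\mathbf C\to\mathbf A$, $\kappa_1:\mathbf C\to\mathbf B$ there exist $\mathbf D\in\mathcal K$ and embeddings $\iota:\mathbf A\to\mathbf D$, $\kappa:\mathbf B\to\mathbf D$ with $\iota\circ\iota_1=\kappa\circ\kappa_1$. -}

module Defs where

open import Level using (0ℓ)
open import Data.Product using (Σ; _×_; _,_)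
open import Relation.Binary.PropositionalEquality using (_≡_)
open import Relation.Binary.Definitions using (Reflexive; Transitive)
open import Function.Definitions using (Injective)

record IsPreorderRel {X : Set} (R : X → X → Set) : Set where
  field
    refl  : Reflexive R
    trans : Transitive R

record UDPS : Set₁ where
  field
    Carrier : Set
    _≤₁_ : Carrier → Carrier → Set
    _≤₂_ : Carrier → Carrier → Set
    isPre₁ : IsPreorderRel _≤₁_
    isPre₂ : IsPreorderRel _≤₂_
    condU : ∀ {x y} → x ≤₁ y → x ≤₂ y → x ≡ y

open UDPS

record Embedding (A B : UDPS) : Set where
  field
    map : Carrier A → Carrier B
    injective : Injective _≡_ _≡_ map
    pres₁ : ∀ x y → _≤₁_ A x y → _≤₁_ B (map x) (map y)
    refl₁ : ∀ x y → _≤₁_ B (map x) (map y) → _≤₁_ A x y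
    pres₂ : ∀ x y → _≤₂_ A x y → _≤₂_ B (map x) (map y)
    refl₂ : ∀ x y → _≤₂_ B (map x) (map y) → _≤₂_ A x y

open Embedding

AmalgamationProperty : Set₁
AmalgamationProperty =
  (A B C : UDPS) (ι₁ : Embedding C A) (κ₁ : Embedding C B) →
  Σ UDPS λ D → Σ (Embedding A D) λ ι → Σ (Embedding B D) λ κ →
    ∀ (c : Carrier C) → map ι (map ι₁ c) ≡ map κ (map κ₁ c)

-- Glue a "cone" A = {⊥, a, b} with ⊥ ≤₁ a, ⊥ ≤₂ b and a "cocone" B = {a, b, ⊤} with
-- a ≤₁ ⊤, b ≤₂ ⊤ over the discrete two-element set {a, b}. In an amalgam, ⊥ ≤₁ a ≤₁ ⊤
-- and ⊥ ≤₂ b ≤₂ ⊤, so condition (U) forces ⊥ = ⊤. Then a ≤₁ ⊤ = ⊥ would hold in the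
-- amalgam, and since the embedding of A reflects ≤₁ it would hold in A, which it does not.
module Submission where

open import Defs
open import Data.Empty using (⊥-elim)
open import Data.Bool using (Bool; false; true)
open import Data.Maybe using (Maybe; just; nothing)
open import Data.Maybe.Properties using (just-injective)
open import Data.Product using (_×_; _,_)
open import Data.Sum using (_⊎_; inj₁; inj₂)
open import Relation.Nullary using (¬_)
open import Relation.Binary.PropositionalEquality
  using (_≡_; refl; sym; trans; subst; subst₂)

open UDPS
open Embedding

condU-trans : (D : UDPS) {x y₁ y₂ z : Carrier D} →
              _≤₁_ D x y₁ → _≤₁_ D y₁ z → _≤₂_ D x y₂ → _≤₂_ D y₂ z → x ≡ z
condU-trans D x≤₁y₁ y₁≤₁z x≤₂y₂ y₂≤₂z =
  condU D (IsPreorderRel.trans (isPre₁ D) x≤₁y₁ y₁≤₁z)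
          (IsPreorderRel.trans (isPre₂ D) x≤₂y₂ y₂≤₂z)

discrete : Set → UDPS
discrete X = record
  { Carrier = X ; _≤₁_ = _≡_ ; _≤₂_ = _≡_
  ; isPre₁ = ≡-isPreorder ; isPre₂ = ≡-isPreorder
  ; condU = λ x≡y _ → x≡y
  }
  where
  ≡-isPreorder : IsPreorderRel {X} _≡_
  ≡-isPreorder = record { refl = refl ; trans = trans }

data Arrow {X : Set} (u v : X) : X → X → Set where
  rfl   : ∀ {x} → Arrow u v x x
  arrow : Arrow u v u v

Arrow-trans : ∀ {X} {u v x y z : X} → Arrow u v x y → Arrow u v y z → Arrow u v x z
Arrow-trans rfl   q     = q
Arrow-trans arrow rfl   = arrow
Arrow-trans arrow arrow = arrow

Arrow-isPreorder : ∀ {X} {u v : X} → IsPreorderRel (Arrow u v)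
Arrow-isPreorder = record { refl = rfl ; trans = Arrow-trans }

Arrow-condU : ∀ {X} {u₁ v₁ u₂ v₂ x y : X} → ¬ (u₁ ≡ u₂ × v₁ ≡ v₂) →
              Arrow u₁ v₁ x y → Arrow u₂ v₂ x y → x ≡ y
Arrow-condU distinct rfl   _     = refl
Arrow-condU distinct arrow rfl   = refl
Arrow-condU distinct arrow arrow = ⊥-elim (distinct (refl , refl))

twoArrows : {X : Set} (u₁ v₁ u₂ v₂ : X) → ¬ (u₁ ≡ u₂ × v₁ ≡ v₂) → UDPS
twoArrows {X} u₁ v₁ u₂ v₂ distinct = record
  { Carrier = X ; _≤₁_ = Arrow u₁ v₁ ; _≤₂_ = Arrow u₂ v₂
  ; isPre₁ = Arrow-isPreorder ; isPre₂ = Arrow-isPreorder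
  ; condU = Arrow-condU distinct
  }

TouchesNothing : {X : Set} → Maybe X → Maybe X → Set
TouchesNothing u v = u ≡ nothing ⊎ v ≡ nothing

Arrow-just-reflects : ∀ {X} {u v : Maybe X} {x y} → TouchesNothing u v →
                      Arrow u v (just x) (just y) → x ≡ y
Arrow-just-reflects _          rfl   = refl
Arrow-just-reflects (inj₁ ()) arrow
Arrow-just-reflects (inj₂ ()) arrow

Arrow-just-preserves : ∀ {X} {u v : Maybe X} x y → x ≡ y → Arrow u v (just x) (just y)
Arrow-just-preserves x .x refl = rfl

justEmbedding : {X : Set} {u₁ v₁ u₂ v₂ : Maybe X} (distinct : ¬ (u₁ ≡ u₂ × v₁ ≡ v₂)) →
                TouchesNothing u₁ v₁ → TouchesNothing u₂ v₂ →
                Embedding (discrete X) (twoArrows u₁ v₁ u₂ v₂ distinct)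
justEmbedding _ touches₁ touches₂ = record
  { map = just ; injective = just-injective
  ; pres₁ = Arrow-just-preserves ; refl₁ = λ _ _ → Arrow-just-reflects touches₁
  ; pres₂ = Arrow-just-preserves ; refl₂ = λ _ _ → Arrow-just-reflects touches₂
  }

-- Both live on Maybe Bool: nothing is the apex (⊥ of the cone, ⊤ of the cocone),
-- just false is a and just true is b.
cone cocone : UDPS
cone   = twoArrows nothing (just false) nothing (just true) λ { (_ , ()) }
cocone = twoArrows (just false) nothing (just true) nothing λ { (() , _) }

¬a≤₁⊥-in-cone : ¬ _≤₁_ cone (just false) nothing
¬a≤₁⊥-in-cone ()

theorem5p1 : ¬ AmalgamationProperty
theorem5p1 amalgamation
  with amalgamation cone cocone (discrete Bool)
         (justEmbedding _ (inj₁ refl) (inj₁ refl)) (justEmbedding _ (inj₂ refl) (inj₂ refl))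
... | D , ι , κ , commutes = ¬a≤₁⊥-in-cone (refl₁ ι (just false) nothing a≤₁⊥)
  where
  open UDPS D using () renaming (_≤₁_ to _≤₁ᴰ_; _≤₂_ to _≤₂ᴰ_)

  ⊥≡⊤ : map ι nothing ≡ map κ nothing
  ⊥≡⊤ = condU-trans D
    (pres₁ ι nothing (just false) arrow)
    (subst (_≤₁ᴰ map κ nothing) (sym (commutes false)) (pres₁ κ (just false) nothing arrow))
    (pres₂ ι nothing (just true) arrow)
    (subst (_≤₂ᴰ map κ nothing) (sym (commutes true)) (pres₂ κ (just true) nothing arrow))

  a≤₁⊥ : map ι (just false) ≤₁ᴰ map ι nothing
  a≤₁⊥ = subst₂ _≤₁ᴰ_ (sym (commutes false)) (sym ⊥≡⊤) (pres₁ κ (just false) nothing arrow)
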